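{- Let $G=(V,E)$ be a connected Eulerian digraph and $s\in V$, and consider the chip-firing game on $G$ with sink $s$. Let $A$ be a maximal acyclic arc set of $G$ such that $s$ is the unique vertex of in-degree $0$ in $G[A]$. Then the configuration $c$ defined by $c(v)=\mathrm{outdeg}_G(v)-\mathrm{indeg}_{G[A]}(v)$ for every $v\in V\setminus\{s\}$ is a minimal recurrent configuration.
   Context: Digraphs are finite and simple; Eulerian means in-degree equals out-degree at every vertex. For $A\subseteq E$, $G[A]$ is the digraph $(V,A)$; $A$ is an acyclic arc set if $G[A]$ has no directed cycle, and maximal if $A\cup\{e\}$ is not acyclic for every $e\in E\setminus A$. Chip-firing on $G$ with sink $s$ (i.e. on $G$ with all arcs of tail $s$ deleted): a configuration is a map $c:V\setminus\{s\}\to\mathbb{N}$. A vertex $v\neq s$ is active if $c(v)\ge\mathrm{outdeg}_G(v)\ge1$; firing $v$ subtracts $\mathrm{outdeg}_G(v)$ from $c(v)$ and adds one chip to each out-neighbour $w\ne s$ of $v$ (chips sent to $s$ vanish). Legal firing = firing an active vertex; $c\to^*d$ means reachable by legal firings; $c$ stable if no vertex is active. $c$ is accessible if for every configuration $d$ there is $d'$ with $d+d'\to^*c$; recurrent if stable and accessible. $c'\le c$ is componentwise; a recurrent $c$ is minimal if no recurrent $c'\ne c$ has $c'\le c$. -}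

module Defs where

open import Data.Nat using (ℕ; zero; suc; _+_; _∸_; _≤_; _≥_)
open import Data.Fin using (Fin; _≟_)
open import Data.Bool using (Bool; true; false; if_then_else_)
open import Data.List using (List; map; allFin)
open import Data.Nat.ListAction using (sum)
open import Data.Product using (Σ; _×_; _,_; ∃)
open import Data.Sum using (_⊎_)
open import Relation.Nullary using (¬_; yes; no)
open import Relation.Binary.PropositionalEquality using (_≡_; _≢_)

-- Finite simple digraphs on vertex set Fin n.
-- Arcs are given by a Boolean adjacency relation (so no multiple arcs),
-- and there are no loops.

record Digraph (n : ℕ) : Set where
  field
    arc      : Fin n → Fin n → Bool
    loopless : ∀ v → arc v v ≡ false
open Digraph public

ArcSet : ℕ → Set
ArcSet n = Fin n → Fin n → Bool

_⊆Arcs_ : ∀ {n} → ArcSet n → Digraph n → Set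
A ⊆Arcs G = ∀ u v → A u v ≡ true → arc G u v ≡ true

indicator : Bool → ℕ
indicator true  = 1
indicator false = 0

outdegA : ∀ {n} → ArcSet n → Fin n → ℕ
outdegA {n} A v = sum (map (λ w → indicator (A v w)) (allFin n))

indegA : ∀ {n} → ArcSet n → Fin n → ℕ
indegA {n} A v = sum (map (λ u → indicator (A u v)) (allFin n))

outdeg : ∀ {n} → Digraph n → Fin n → ℕ
outdeg G = outdegA (arc G)

indeg : ∀ {n} → Digraph n → Fin n → ℕ
indeg G = indegA (arc G)

Eulerian : ∀ {n} → Digraph n → Set
Eulerian G = ∀ v → indeg G v ≡ outdeg G v

-- Connectivity (weak connectivity: connected underlying undirected graph;
-- for Eulerian digraphs this coincides with strong connectivity).

data UWalk {n} (G : Digraph n) : Fin n → Fin n → Set where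
  here : ∀ {v} → UWalk G v v
  fwd  : ∀ {u v w} → arc G u v ≡ true → UWalk G v w → UWalk G u w
  bwd  : ∀ {u v w} → arc G v u ≡ true → UWalk G v w → UWalk G u w

Connected : ∀ {n} → Digraph n → Set
Connected G = ∀ u v → UWalk G u v

data Walk⁺ {n} (A : ArcSet n) : Fin n → Fin n → Set where
  one  : ∀ {u v} → A u v ≡ true → Walk⁺ A u v
  cons : ∀ {u v w} → A u v ≡ true → Walk⁺ A v w → Walk⁺ A u w

-- G[A] has no directed cycle (equivalently, no closed directed walk of
-- positive length).
Acyclic : ∀ {n} → ArcSet n → Set
Acyclic A = ∀ v → ¬ Walk⁺ A v v

addArc : ∀ {n} → ArcSet n → Fin n → Fin n → ArcSet n
addArc A x y u v with u ≟ x | v ≟ y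
... | yes _ | yes _ = true
... | _     | _     = A u v

MaximalAcyclic : ∀ {n} → Digraph n → ArcSet n → Set
MaximalAcyclic G A =
  A ⊆Arcs G × Acyclic A ×
  (∀ x y → arc G x y ≡ true → A x y ≡ false → ¬ Acyclic (addArc A x y))

-- A configuration is a map V ∖ {s} → ℕ; we represent it as a map
-- c : Fin n → ℕ subject to the normalisation c s ≡ 0 (the value at the
-- sink carries no information).

Config : ℕ → Set
Config n = Fin n → ℕ

IsConfig : ∀ {n} → Fin n → Config n → Set
IsConfig s c = c s ≡ 0

module ChipFiring {n : ℕ} (G : Digraph n) (s : Fin n) where

  Active : Config n → Fin n → Set
  Active c v = v ≢ s × 1 ≤ outdeg G v × outdeg G v ≤ c v

  fire : Fin n → Config n → Config n
  fire v c w with w ≟ s | w ≟ v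
  ... | yes _ | _     = 0
  ... | no _  | yes _ = (c w ∸ outdeg G v) + indicator (arc G v w)
  ... | no _  | no _  = c w + indicator (arc G v w)

  Step : Config n → Config n → Set
  Step c d = Σ (Fin n) λ v → Active c v × (∀ w → d w ≡ fire v c w)

  data _→*_ : Config n → Config n → Set where
    done : ∀ {c d} → (∀ w → c w ≡ d w) → c →* d
    step : ∀ {c d e} → Step c d → d →* e → c →* e

  Stable : Config n → Set
  Stable c = ∀ v → ¬ Active c v

  _⊕_ : Config n → Config n → Config n
  (c ⊕ d) w = c w + d w

  Accessible : Config n → Set
  Accessible c = ∀ d → IsConfig s d →
    Σ (Config n) λ d' → IsConfig s d' × ((d ⊕ d') →* c)

  Recurrent : Config n → Set
  Recurrent c = IsConfig s c × Stable c × Accessible c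

  _≤C_ : Config n → Config n → Set
  c' ≤C c = ∀ v → c' v ≤ c v

  _≈C_ : Config n → Config n → Set
  c' ≈C c = ∀ v → c' v ≡ c v

  MinimalRecurrent : Config n → Set
  MinimalRecurrent c = Recurrent c ×
    (∀ c' → Recurrent c' → c' ≤C c → c' ≈C c)

configOf : ∀ {n} → Digraph n → Fin n → ArcSet n → Config n
configOf G s A v with v ≟ s
... | yes _ = 0
... | no _  = outdeg G v ∸ indegA A v

module Submission where

-- Lemma 14: for a maximal acyclic arc set A of an Eulerian digraph G whose
-- only source is the sink s, c(v) = outdeg_G(v) − indeg_A(v) is a minimal
-- recurrent configuration.
--
-- Stability: each v ≠ s has an A-predecessor, so c(v) < outdeg(v).
-- Accessibility is shown by running firings backwards.  "Unfiring" a set X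
-- yields a configuration from which firing X once, A-sources first, returns
-- (fire-set, unfire→*); members of X gain one chip per arc entering X.  The
-- layers V∖{s} = L₀ ⊇ L₁ ⊇ ⋯, where L_{j+1} drops the vertices of L_j entered
-- from outside, reach ∅ since every nonempty set is entered by an arc (the
-- A-predecessor of an A-source).  Unfiring the layers in turn (pump) gives
-- configurations relaxing to c with arbitrarily many chips everywhere.
-- Minimality: if c' ≤ c is recurrent and c'(w) < c(w), let S be the set of
-- vertices A-reachable from w.  Maximality of A makes every G-arc entering S
-- an A-arc, so c'(v) is below the number of arcs from S into v for all v ∈ S;
-- yet the vertex of S firing last on the way to c' has that many chips
-- (stable-accessible-slack).

open import Defs
open import Data.Nat using (ℕ; zero; suc; _+_; _∸_; _*_; _≤_; _<_; z≤n; s≤s; _≡ᵇ_)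
open import Data.Nat.Properties hiding (_≟_)
import Data.Nat.Properties as ℕ using (_≟_)
open import Data.Nat.ListAction using () renaming (sum to listSum)
open import Data.Fin using (Fin; _≟_; toℕ) renaming (zero to fzero; suc to fsuc)
open import Data.Fin.Properties using (any?; pigeonhole)
open import Data.Bool using (Bool; true; false; _∧_; _∨_; not; if_then_else_)
open import Data.Bool.Properties as B using (∧-assoc)
open import Data.List using (tabulate)
open import Data.List.Properties using (map-tabulate)
open import Data.Product using (Σ; _×_; _,_; ∃; proj₁; proj₂)
open import Data.Sum using (_⊎_; inj₁; inj₂)
open import Data.Empty using (⊥; ⊥-elim)
open import Function using (id; _∘_)
open import Relation.Nullary using (¬_; yes; no; Dec; does)
open import Relation.Nullary.Decidable using (dec-true; dec-false; _×-dec_; ¬¬-excluded-middle)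
open import Relation.Binary.PropositionalEquality
open import Relation.Binary.Construct.Closure.ReflexiveTransitive using (Star; ε; _◅_; _◅◅_)

open import Algebra.Properties.CommutativeMonoid.Sum +-0-commutativeMonoid
  using (sum-cong-≗; ∑-distrib-+; sum-syntax)

¬¬-decidable : ∀ {m} (P : Fin m → Set) → ¬ ¬ (∀ x → Dec (P x))
¬¬-decidable {zero}  P no-dec = no-dec (λ ())
¬¬-decidable {suc m} P no-dec = ¬¬-excluded-middle λ P0? →
  ¬¬-decidable (P ∘ fsuc) λ rest? → no-dec λ { fzero → P0? ; (fsuc x) → rest? x }

∧-true : ∀ {a b} → a ∧ b ≡ true → a ≡ true × b ≡ true
∧-true {true} {true} _ = refl , refl

∧-intro : ∀ {a b} → a ≡ true → b ≡ true → a ∧ b ≡ true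
∧-intro refl refl = refl

∧-false : ∀ {a b} → a ∧ b ≡ false → b ≡ true → a ≡ false
∧-false {false}        _  _ = refl
∧-false {true}  {true} () _

∨-false : ∀ {a b} → a ∨ b ≡ false → a ≡ false × b ≡ false
∨-false {false} {false} _ = refl , refl

∨-left : ∀ {a b} → a ∨ b ≡ true → b ≡ false → a ≡ true
∨-left {true}          _  _  = refl
∨-left {false} {true}  _  ()

not-true : ∀ {a} → not a ≡ true → a ≡ false
not-true {false} _ = refl

does-true : ∀ {n} {x y : Fin n} → does (x ≟ y) ≡ true → x ≡ y
does-true {x = x} {y} eq with x ≟ y
... | yes x≡y = x≡y

does-false : ∀ {n} {x y : Fin n} → does (x ≟ y) ≡ false → x ≢ y
does-false {x = x} {y} eq x≡y with x ≟ y
... | no x≢y = x≢y x≡y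

count : ∀ {n} → (Fin n → Bool) → ℕ
count {n} b = ∑[ i < n ] indicator (b i)

listSum-tabulate : ∀ {n} (f : Fin n → ℕ) → listSum (tabulate f) ≡ ∑[ i < n ] f i
listSum-tabulate {zero}  f = refl
listSum-tabulate {suc n} f = cong (f fzero +_) (listSum-tabulate (f ∘ fsuc))

indegA-count : ∀ {n} (R : ArcSet n) v → indegA R v ≡ count (λ u → R u v)
indegA-count R v = trans (cong listSum (map-tabulate id f)) (listSum-tabulate f)
  where
  f : Fin _ → ℕ
  f u = indicator (R u v)

∑-mono : ∀ {n} {f g : Fin n → ℕ} → (∀ i → f i ≤ g i) → ∑[ i < n ] f i ≤ ∑[ i < n ] g i
∑-mono {zero}  f≤g = z≤n
∑-mono {suc n} f≤g = +-mono-≤ (f≤g fzero) (∑-mono (f≤g ∘ fsuc))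

∑-term : ∀ {n} (f : Fin n → ℕ) i → f i ≤ ∑[ j < n ] f j
∑-term f fzero    = m≤m+n (f fzero) _
∑-term f (fsuc i) = ≤-trans (∑-term (f ∘ fsuc) i) (m≤n+m _ (f fzero))

indicator≤1 : ∀ b → indicator b ≤ 1
indicator≤1 true  = ≤-refl
indicator≤1 false = z≤n

indicator-mono : ∀ {b b'} → (b ≡ true → b' ≡ true) → indicator b ≤ indicator b'
indicator-mono {false} b⇒b' = z≤n
indicator-mono {true}  b⇒b' rewrite b⇒b' refl = ≤-refl

count-cong : ∀ {n} {b b' : Fin n → Bool} → (∀ i → b i ≡ b' i) → count b ≡ count b'
count-cong b≗b' = sum-cong-≗ (cong indicator ∘ b≗b')

count-mono : ∀ {n} {b b' : Fin n → Bool} → (∀ i → b i ≡ true → b' i ≡ true) → count b ≤ count b'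
count-mono b⇒b' = ∑-mono (λ i → indicator-mono (b⇒b' i))

count≤size : ∀ {n} (b : Fin n → Bool) → count b ≤ n
count≤size {zero}  b = z≤n
count≤size {suc n} b = +-mono-≤ (indicator≤1 (b fzero)) (count≤size (b ∘ fsuc))

count-member : ∀ {n} (b : Fin n → Bool) i → b i ≡ true → 1 ≤ count b
count-member b i bi = ≤-trans (≤-reflexive (cong indicator (sym bi))) (∑-term (indicator ∘ b) i)

count-zero : ∀ {n} (b : Fin n → Bool) → count b ≡ 0 → ∀ i → b i ≡ false
count-zero b none i with b i in bi
... | false = refl
... | true  with subst (1 ≤_) none (count-member b i bi)
...   | ()

count-witness : ∀ {n} (b : Fin n → Bool) → 1 ≤ count b → ∃ λ i → b i ≡ true
count-witness {suc n} b pos with b fzero in b0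
... | true  = fzero , b0
... | false = let (i , bi) = count-witness (b ∘ fsuc) pos in fsuc i , bi

count-split : ∀ {n} (p b : Fin n → Bool) →
  count b ≡ count (λ i → p i ∧ b i) + count (λ i → not (p i) ∧ b i)
count-split {n} p b =
  trans (sum-cong-≗ pointwise) (∑-distrib-+ (λ i → indicator (p i ∧ b i)) (λ i → indicator (not (p i) ∧ b i)))
  where
  pointwise : ∀ i → indicator (b i) ≡ indicator (p i ∧ b i) + indicator (not (p i) ∧ b i)
  pointwise i with p i
  ... | true  = sym (+-identityʳ _)
  ... | false = refl

count-none : ∀ {n} → count {n} (λ _ → false) ≡ 0
count-none {zero}  = refl
count-none {suc n} = count-none {n}

count-singleton : ∀ {n} (j : Fin n) (b : Fin n → Bool) →
  count (λ i → does (i ≟ j) ∧ b i) ≡ indicator (b j)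
count-singleton {suc n} fzero    b = trans (cong (indicator (b fzero) +_) (count-none {n})) (+-identityʳ _)
count-singleton {suc n} (fsuc j) b = count-singleton j (b ∘ fsuc)

count-remove : ∀ {n} (b : Fin n → Bool) {j} → b j ≡ true →
  count b ≡ suc (count (λ i → not (does (i ≟ j)) ∧ b i))
count-remove b {j} bj = begin
  count b                                ≡⟨ count-split (λ i → does (i ≟ j)) b ⟩
  count (λ i → does (i ≟ j) ∧ b i) + rest ≡⟨ cong (_+ rest) (count-singleton j b) ⟩
  indicator (b j) + rest                 ≡⟨ cong (λ x → indicator x + rest) bj ⟩
  suc rest                               ∎
  where
  open ≡-Reasoning
  rest : ℕ
  rest = count (λ i → not (does (i ≟ j)) ∧ b i)

VertexSet : ℕ → Set
VertexSet n = Fin n → Bool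

∁ : ∀ {n} → VertexSet n → VertexSet n
∁ X u = not (X u)

_∖_ : ∀ {n} → VertexSet n → Fin n → VertexSet n
(X ∖ w) u = not (does (u ≟ w)) ∧ X u

arcsFrom : ∀ {n} → ArcSet n → VertexSet n → Fin n → ℕ
arcsFrom R X v = count (λ u → X u ∧ R u v)

indeg-split : ∀ {n} (R : ArcSet n) X v → indegA R v ≡ arcsFrom R X v + arcsFrom R (∁ X) v
indeg-split R X v = trans (indegA-count R v) (count-split X (λ u → R u v))

arcsFrom-remove : ∀ {n} (R : ArcSet n) X {w} → X w ≡ true → ∀ v →
  arcsFrom R X v ≡ indicator (R w v) + arcsFrom R (X ∖ w) v
arcsFrom-remove R X {w} Xw v = begin
  arcsFrom R X v
    ≡⟨ count-split (λ u → does (u ≟ w)) (λ u → X u ∧ R u v) ⟩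
  count (λ u → does (u ≟ w) ∧ (X u ∧ R u v)) + count (λ u → not (does (u ≟ w)) ∧ (X u ∧ R u v))
    ≡⟨ cong₂ _+_ (count-singleton w (λ u → X u ∧ R u v))
                 (count-cong (λ u → sym (∧-assoc (not (does (u ≟ w))) (X u) (R u v)))) ⟩
  indicator (X w ∧ R w v) + arcsFrom R (X ∖ w) v
    ≡⟨ cong (λ b → indicator (b ∧ R w v) + arcsFrom R (X ∖ w) v) Xw ⟩
  indicator (R w v) + arcsFrom R (X ∖ w) v ∎
  where open ≡-Reasoning

arcsFrom-insert : ∀ {n} (R : ArcSet n) u F v →
  arcsFrom R (λ x → does (x ≟ u) ∨ F x) v ≤ indicator (R u v) + arcsFrom R F v
arcsFrom-insert {n} R u F v = begin
  arcsFrom R (λ x → does (x ≟ u) ∨ F x) v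
    ≤⟨ ∑-mono pointwise ⟩
  ∑[ x < n ] (indicator (does (x ≟ u) ∧ R x v) + indicator (F x ∧ R x v))
    ≡⟨ ∑-distrib-+ (λ x → indicator (does (x ≟ u) ∧ R x v)) (λ x → indicator (F x ∧ R x v)) ⟩
  count (λ x → does (x ≟ u) ∧ R x v) + arcsFrom R F v
    ≡⟨ cong (_+ arcsFrom R F v) (count-singleton u (λ x → R x v)) ⟩
  indicator (R u v) + arcsFrom R F v ∎
  where
  open ≤-Reasoning
  pointwise : ∀ x → indicator ((does (x ≟ u) ∨ F x) ∧ R x v)
                  ≤ indicator (does (x ≟ u) ∧ R x v) + indicator (F x ∧ R x v)
  pointwise x with does (x ≟ u)
  ... | true  = m≤m+n _ _
  ... | false = ≤-refl

Reach : ∀ {n} → ArcSet n → Fin n → Fin n → Set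
Reach R = Star (λ u v → R u v ≡ true)

walk⇒reach : ∀ {n} {R : ArcSet n} {u v} → Walk⁺ R u v → Reach R u v
walk⇒reach (one a)    = a ◅ ε
walk⇒reach (cons a w) = a ◅ walk⇒reach w

reach-last : ∀ {n} {R : ArcSet n} {w v} → Reach R w v →
  w ≡ v ⊎ ∃ λ y → Reach R w y × R y v ≡ true
reach-last ε       = inj₁ refl
reach-last (a ◅ p) with reach-last p
... | inj₁ refl          = inj₂ (_ , ε , a)
... | inj₂ (y , q , a') = inj₂ (y , a ◅ q , a')

addArc-arc : ∀ {n} (R : ArcSet n) x y u v →
  addArc R x y u v ≡ true → (u ≡ x × v ≡ y) ⊎ R u v ≡ true
addArc-arc R x y u v a with u ≟ x | v ≟ y
... | yes u≡x | yes v≡y = inj₁ (u≡x , v≡y)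
... | yes _   | no _    = inj₂ a
... | no _    | _       = inj₂ a

addArc-walk : ∀ {n} {R : ArcSet n} {x y a b} → Walk⁺ (addArc R x y) a b →
  Walk⁺ R a b ⊎ (Reach R a x × Reach R y b)
addArc-walk {R = R} {x} {y} {a} {b} (one e) with addArc-arc R x y a b e
... | inj₁ (refl , refl) = inj₂ (ε , ε)
... | inj₂ e'            = inj₁ (one e')
addArc-walk {R = R} {x} {y} {a} (cons {v = a'} e w) with addArc-arc R x y a a' e | addArc-walk w
... | inj₁ (refl , refl) | inj₁ w'        = inj₂ (ε , walk⇒reach w')
... | inj₁ (refl , refl) | inj₂ (_ , q)   = inj₂ (ε , q)
... | inj₂ e'            | inj₁ w'        = inj₁ (cons e' w')
... | inj₂ e'            | inj₂ (p , q)   = inj₂ (e' ◅ p , q)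

addArc-acyclic : ∀ {n} {R : ArcSet n} {x y} → Acyclic R → ¬ Reach R y x → Acyclic (addArc R x y)
addArc-acyclic acyclic ¬y⇝x z w with addArc-walk w
... | inj₁ w'       = acyclic z w'
... | inj₂ (p , q) = ¬y⇝x (q ◅◅ p)

-- If every member of a nonempty set Y has a predecessor in Y, following
-- predecessors n + 1 times from a member revisits a vertex: a cycle.
predecessors⇒cycle : ∀ {n} (R : ArcSet n) (Y : VertexSet n) →
  (∀ w → Y w ≡ true → ∃ λ u → R u w ≡ true × Y u ≡ true) →
  ∀ {v} → Y v ≡ true → ∃ λ x → Walk⁺ R x x
predecessors⇒cycle {n} R Y pred {v} Yv = cycle
  where
  Member : Set
  Member = Σ (Fin n) λ x → Y x ≡ true

  back : ℕ → Member
  back zero    = v , Yv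
  back (suc k) = let (x , Yx) = back k in proj₁ (pred x Yx) , proj₂ (proj₂ (pred x Yx))

  vertex : ℕ → Fin n
  vertex k = proj₁ (back k)

  back-arc : ∀ k → R (vertex (suc k)) (vertex k) ≡ true
  back-arc k = proj₁ (proj₂ (pred (vertex k) (proj₂ (back k))))

  descent : ∀ m k → Walk⁺ R (vertex (suc (m + k))) (vertex k)
  descent zero    k = one (back-arc k)
  descent (suc m) k = cons (back-arc (suc (m + k))) (descent m k)

  cycle : ∃ λ x → Walk⁺ R x x
  cycle with pigeonhole (n<1+n n) (λ i → vertex (toℕ i))
  ... | i , j , i<j , same with m≤n⇒∃[o]m+o≡n i<j
  ...   | o , i+o≡j = vertex (toℕ i) , subst (λ x → Walk⁺ R x (vertex (toℕ i))) (sym same)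
                        (subst (λ k → Walk⁺ R (vertex k) (vertex (toℕ i)))
                               (trans (cong suc (+-comm o (toℕ i))) i+o≡j) (descent o (toℕ i)))

acyclic-source : ∀ {n} {R : ArcSet n} → Acyclic R → (Y : VertexSet n) → ∀ {v} → Y v ≡ true →
  ∃ λ w → Y w ≡ true × arcsFrom R Y w ≡ 0
acyclic-source {n} {R} acyclic Y Yv with any? (λ w → (Y w B.≟ true) ×-dec (arcsFrom R Y w ℕ.≟ 0))
... | yes source = source
... | no ¬source = ⊥-elim (acyclic _ (proj₂ (predecessors⇒cycle R Y pred Yv)))
  where
  pred : ∀ w → Y w ≡ true → ∃ λ u → R u w ≡ true × Y u ≡ true
  pred w Yw =
    let (u , YuRuw) = count-witness (λ u → Y u ∧ R u w) (n≢0⇒n>0 (λ none → ¬source (w , Yw , none)))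
        (Yu , Ruw) = ∧-true YuRuw
    in u , Ruw , Yu

module Firing {n} (G : Digraph n) (s : Fin n) where
  open ChipFiring G s

  fire-sink : ∀ v c → fire v c s ≡ 0
  fire-sink v c with s ≟ s
  ... | yes _  = refl
  ... | no s≢s = ⊥-elim (s≢s refl)

  fire-self : ∀ v c → v ≢ s → fire v c v ≡ c v ∸ outdeg G v
  fire-self v c v≢s with v ≟ s | v ≟ v
  ... | yes v≡s | _      = ⊥-elim (v≢s v≡s)
  ... | no _    | no v≢v = ⊥-elim (v≢v refl)
  ... | no _    | yes _  rewrite loopless G v = +-identityʳ _

  fire-other : ∀ v c w → w ≢ s → w ≢ v → fire v c w ≡ c w + indicator (arc G v w)
  fire-other v c w w≢s w≢v with w ≟ s | w ≟ v
  ... | yes w≡s | _       = ⊥-elim (w≢s w≡s)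
  ... | no _    | yes w≡v = ⊥-elim (w≢v w≡v)
  ... | no _    | no _    = refl

  fire-cong : ∀ v {c c'} → c ≈C c' → fire v c ≈C fire v c'
  fire-cong v c≈c' w with w ≟ s | w ≟ v
  ... | yes _ | _     = refl
  ... | no _  | yes _ = cong (λ x → x ∸ outdeg G v + indicator (arc G v w)) (c≈c' w)
  ... | no _  | no _  = cong (_+ indicator (arc G v w)) (c≈c' w)

  →*-resp : ∀ {c c' d} → c ≈C c' → c' →* d → c →* d
  →*-resp c≈c' (done c'≈d) = done (λ w → trans (c≈c' w) (c'≈d w))
  →*-resp c≈c' (step (v , (v≢s , out-pos , enough) , fired) r) =
    step (v , (v≢s , out-pos , subst (outdeg G v ≤_) (sym (c≈c' v)) enough)
            , (λ w → trans (fired w) (fire-cong v (sym ∘ c≈c') w))) r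

  →*-trans : ∀ {c d e} → c →* d → d →* e → c →* e
  →*-trans (done c≈d) r = →*-resp c≈d r
  →*-trans (step st r) r' = step st (→*-trans r r')

  fired : ∀ {c d} → c →* d → VertexSet n
  fired (done _)         x = false
  fired (step (v , _) r) x = does (x ≟ v) ∨ fired r x

  unfired-gain : ∀ {c d} (r : c →* d) v → v ≢ s → fired r v ≡ false →
    c v + arcsFrom (arc G) (fired r) v ≤ d v
  unfired-gain {c} (done c≈d) v v≢s _ =
    ≤-reflexive (trans (cong (c v +_) (count-none {n})) (trans (+-identityʳ (c v)) (c≈d v)))
  unfired-gain {c} {d} (step {d = c₁} (u , _ , fired₁) r) v v≢s unfired =
    let (v≠u , unfired-r) = ∨-false {does (v ≟ u)} unfired
        c₁v : c₁ v ≡ c v + indicator (arc G u v)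
        c₁v = trans (fired₁ v) (fire-other u c v v≢s (does-false v≠u))
    in begin
      c v + arcsFrom (arc G) (λ x → does (x ≟ u) ∨ fired r x) v
        ≤⟨ +-monoʳ-≤ (c v) (arcsFrom-insert (arc G) u (fired r) v) ⟩
      c v + (indicator (arc G u v) + arcsFrom (arc G) (fired r) v)
        ≡⟨ sym (+-assoc (c v) _ _) ⟩
      c v + indicator (arc G u v) + arcsFrom (arc G) (fired r) v
        ≡⟨ cong (_+ arcsFrom (arc G) (fired r) v) (sym c₁v) ⟩
      c₁ v + arcsFrom (arc G) (fired r) v
        ≤⟨ unfired-gain r v v≢s unfired-r ⟩
      d v ∎
    where open ≤-Reasoning

  -- If every vertex of S fires along r, then a vertex of S firing last ends
  -- with at least one chip per arc entering it from S.
  last-fired : ∀ {c d} (r : c →* d) (S : VertexSet n) → (∀ x → S x ≡ true → fired r x ≡ true) →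
    ∀ {w} → S w ≡ true → ∃ λ v → S v ≡ true × arcsFrom (arc G) S v ≤ d v
  last-fired (done _) S all-fire {w} Sw with all-fire w Sw
  ... | ()
  last-fired (step {d = c₁} (u , (u≢s , _) , _) r) S all-fire Sw
    with any? (λ x → (S x ∧ not (fired r x)) B.≟ true)
  ... | no ¬last = last-fired r S fire-again Sw
    where
    fire-again : ∀ x → S x ≡ true → fired r x ≡ true
    fire-again x Sx with fired r x in eq
    ... | true  = refl
    ... | false = ⊥-elim (¬last (x , ∧-intro Sx (cong not eq)))
  ... | yes (x , last) with ∧-true {S x} last
  ...   | (Sx , not-again) with does-true {x = x} {u} (∨-left (all-fire x Sx) (not-true not-again))
  ...     | refl = u , Sx , (begin
      arcsFrom (arc G) S u                        ≤⟨ count-mono fired-again ⟩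
      arcsFrom (arc G) (fired r) u                ≤⟨ m≤n+m _ (c₁ u) ⟩
      c₁ u + arcsFrom (arc G) (fired r) u         ≤⟨ unfired-gain r u u≢s (not-true not-again) ⟩
      _ ∎)
    where
    open ≤-Reasoning
    fired-again : ∀ y → S y ∧ arc G y u ≡ true → fired r y ∧ arc G y u ≡ true
    fired-again y SyGyu with ∧-true {S y} SyGyu | y ≟ u
    ... | (Sy , Gyu) | no y≢u   = ∧-intro (subst (λ b → b ∨ fired r y ≡ true) (dec-false (y ≟ u) y≢u) (all-fire y Sy)) Gyu
    ... | (_ , Gyu)  | yes refl with trans (sym Gyu) (loopless G y)
    ...   | ()

  saturated : Config n
  saturated v = if does (v ≟ s) then 0 else outdeg G v

  saturated-sink : saturated s ≡ 0
  saturated-sink rewrite dec-true (s ≟ s) refl = refl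

  saturated-nonsink : ∀ v → v ≢ s → saturated v ≡ outdeg G v
  saturated-nonsink v v≢s rewrite dec-false (v ≟ s) v≢s = refl

  -- In a stable accessible configuration c, every nonempty set S of non-sink
  -- vertices has a member v with at least as many chips as arcs entering v
  -- from S.  (Add chips to saturated to reach c: each vertex of S must fire,
  -- or it would end active; then apply last-fired.)
  stable-accessible-slack : (∀ v → v ≢ s → 1 ≤ outdeg G v) →
    ∀ {c} → Stable c → Accessible c →
    (S : VertexSet n) → (∀ x → S x ≡ true → x ≢ s) →
    ∀ {w} → S w ≡ true → ∃ λ v → S v ≡ true × arcsFrom (arc G) S v ≤ c v
  stable-accessible-slack out-pos {c} stable accessible S S-nonsink Sw
    with accessible saturated saturated-sink
  ... | d' , _ , r = last-fired r S all-fire Sw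
    where
    all-fire : ∀ x → S x ≡ true → fired r x ≡ true
    all-fire x Sx with fired r x in unfired
    ... | true  = refl
    ... | false = ⊥-elim (stable x (x≢s , out-pos x x≢s , (begin
        outdeg G x                                          ≡⟨ sym (saturated-nonsink x x≢s) ⟩
        saturated x                                         ≤⟨ m≤m+n _ (d' x) ⟩
        (saturated ⊕ d') x                                  ≤⟨ m≤m+n _ _ ⟩
        (saturated ⊕ d') x + arcsFrom (arc G) (fired r) x   ≤⟨ unfired-gain r x x≢s unfired ⟩
        c x                                                 ∎)))
      where
      open ≤-Reasoning
      x≢s : x ≢ s
      x≢s = S-nonsink x Sx

  -- The chips a vertex of Y loses when Y fires.
  load : VertexSet n → Fin n → ℕ
  load Y v = if Y v then outdeg G v else 0

  -- Firing each vertex of Y once turns y into y'.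
  Balanced : VertexSet n → Config n → Config n → Set
  Balanced Y y y' = ∀ v → v ≢ s → y v + arcsFrom (arc G) Y v ≡ y' v + load Y v

  -- Each vertex of Y can fire once its R-predecessors in Y have fired.
  Ready : ArcSet n → VertexSet n → Config n → Set
  Ready R Y y = ∀ v → Y v ≡ true → outdeg G v ≤ y v + arcsFrom R Y v

  balanced-after-firing : ∀ {Y y y' w} → Y w ≡ true → w ≢ s → outdeg G w ≤ y w →
    Balanced Y y y' → Balanced (Y ∖ w) (fire w y) y'
  balanced-after-firing {Y} {y} {y'} {w} Yw w≢s enough balanced v v≢s = by-cases (v ≟ w)
    where
    open ≡-Reasoning
    by-cases : Dec (v ≡ w) → fire w y v + arcsFrom (arc G) (Y ∖ w) v ≡ y' v + load (Y ∖ w) v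
    by-cases (yes refl) = +-cancelʳ-≡ (outdeg G v) _ _ (begin
      fire v y v + rest + outdeg G v         ≡⟨ cong (λ x → x + rest + outdeg G v) (fire-self v y v≢s) ⟩
      y v ∸ outdeg G v + rest + outdeg G v   ≡⟨ +-assoc (y v ∸ outdeg G v) rest _ ⟩
      y v ∸ outdeg G v + (rest + outdeg G v) ≡⟨ cong (y v ∸ outdeg G v +_) (+-comm rest _) ⟩
      y v ∸ outdeg G v + (outdeg G v + rest) ≡⟨ sym (+-assoc (y v ∸ outdeg G v) _ rest) ⟩
      y v ∸ outdeg G v + outdeg G v + rest   ≡⟨ cong (_+ rest) (m∸n+n≡m enough) ⟩
      y v + rest                             ≡⟨ cong (y v +_) (sym from-Y) ⟩
      y v + arcsFrom (arc G) Y v             ≡⟨ balanced v v≢s ⟩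
      y' v + load Y v                        ≡⟨ cong (λ b → y' v + (if b then outdeg G v else 0)) Yw ⟩
      y' v + outdeg G v                      ≡⟨ cong (_+ outdeg G v) (sym unloaded) ⟩
      y' v + load (Y ∖ v) v + outdeg G v     ∎)
      where
      rest : ℕ
      rest = arcsFrom (arc G) (Y ∖ v) v
      from-Y : arcsFrom (arc G) Y v ≡ rest
      from-Y = trans (arcsFrom-remove (arc G) Y Yw v) (cong (λ b → indicator b + rest) (loopless G v))
      unloaded : y' v + load (Y ∖ v) v ≡ y' v
      unloaded rewrite dec-true (v ≟ v) refl = +-identityʳ (y' v)
    by-cases (no v≢w) = begin
      fire w y v + arcsFrom (arc G) (Y ∖ w) v
        ≡⟨ cong (_+ arcsFrom (arc G) (Y ∖ w) v) (fire-other w y v v≢s v≢w) ⟩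
      y v + indicator (arc G w v) + arcsFrom (arc G) (Y ∖ w) v
        ≡⟨ +-assoc (y v) _ _ ⟩
      y v + (indicator (arc G w v) + arcsFrom (arc G) (Y ∖ w) v)
        ≡⟨ cong (y v +_) (sym (arcsFrom-remove (arc G) Y Yw v)) ⟩
      y v + arcsFrom (arc G) Y v
        ≡⟨ balanced v v≢s ⟩
      y' v + load Y v
        ≡⟨ cong (λ b → y' v + (if b ∧ Y v then outdeg G v else 0)) (sym (cong not (dec-false (v ≟ w) v≢w))) ⟩
      y' v + load (Y ∖ w) v ∎

  ready-after-firing : ∀ {R : ArcSet n} → R ⊆Arcs G → ∀ {Y y w} → (∀ v → Y v ≡ true → v ≢ s) →
    Y w ≡ true → Ready R Y y → Ready R (Y ∖ w) (fire w y)
  ready-after-firing {R} R⊆G {Y} {y} {w} Y-nonsink Yw ready v Y∖w-v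
    with ∧-true {not (does (v ≟ w))} Y∖w-v
  ... | (v≠w , Yv) rewrite fire-other w y v (Y-nonsink v Yv) (does-false (not-true v≠w)) = begin
    outdeg G v                                                     ≤⟨ ready v Yv ⟩
    y v + arcsFrom R Y v                                           ≡⟨ cong (y v +_) (arcsFrom-remove R Y Yw v) ⟩
    y v + (indicator (R w v) + arcsFrom R (Y ∖ w) v)               ≤⟨ +-monoʳ-≤ (y v) (+-monoˡ-≤ _ (indicator-mono (R⊆G w v))) ⟩
    y v + (indicator (arc G w v) + arcsFrom R (Y ∖ w) v)           ≡⟨ sym (+-assoc (y v) _ _) ⟩
    y v + indicator (arc G w v) + arcsFrom R (Y ∖ w) v             ∎
    where open ≤-Reasoning

  -- Firing a set Y of non-sink vertices once each, sources first with respect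
  -- to an acyclic R ⊆ G: a balanced and ready y reaches y'.  (Induction on |Y|:
  -- an R-source w of Y is active, and firing it leaves Y ∖ w balanced and ready.)
  fire-set : ∀ {R : ArcSet n} → R ⊆Arcs G → Acyclic R →
    ∀ k (Y : VertexSet n) → count Y ≡ k →
    (∀ v → Y v ≡ true → v ≢ s) → (∀ v → Y v ≡ true → 1 ≤ outdeg G v) →
    ∀ {y y'} → y s ≡ 0 → y' s ≡ 0 → Balanced Y y y' → Ready R Y y → y →* y'
  fire-set R⊆G acyclic zero Y empty Y-nonsink Y-out {y} {y'} ys y's balanced ready = done agree
    where
    agree : y ≈C y'
    agree v with v ≟ s
    ... | yes refl = trans ys (sym y's)
    ... | no v≢s = begin
      y v                        ≡⟨ sym (+-identityʳ (y v)) ⟩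
      y v + 0                    ≡⟨ cong (y v +_) (sym no-arcs) ⟩
      y v + arcsFrom (arc G) Y v ≡⟨ balanced v v≢s ⟩
      y' v + load Y v            ≡⟨ cong (λ b → y' v + (if b then outdeg G v else 0)) (count-zero Y empty v) ⟩
      y' v + 0                   ≡⟨ +-identityʳ (y' v) ⟩
      y' v                       ∎
      where
      open ≡-Reasoning
      no-arcs : arcsFrom (arc G) Y v ≡ 0
      no-arcs = n≤0⇒n≡0 (≤-trans (count-mono (λ u → proj₁ ∘ ∧-true {Y u})) (≤-reflexive empty))
  fire-set R⊆G acyclic (suc k) Y size Y-nonsink Y-out {y} ys y's balanced ready
    with acyclic-source acyclic Y (proj₂ (count-witness Y (subst (1 ≤_) (sym size) (s≤s z≤n))))
  ... | w , Yw , no-R-from-Y =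
    step (w , (w≢s , Y-out w Yw , enough) , λ _ → refl)
         (fire-set R⊆G acyclic k (Y ∖ w) smaller (λ v → Y-nonsink v ∘ in-Y v) (λ v → Y-out v ∘ in-Y v)
                   (fire-sink w y) y's
                   (balanced-after-firing Yw w≢s enough balanced)
                   (ready-after-firing R⊆G Y-nonsink Yw ready))
    where
    w≢s : w ≢ s
    w≢s = Y-nonsink w Yw

    enough : outdeg G w ≤ y w
    enough = ≤-trans (ready w Yw) (≤-reflexive (trans (cong (y w +_) no-R-from-Y) (+-identityʳ (y w))))

    smaller : count (Y ∖ w) ≡ k
    smaller = suc-injective (trans (sym (count-remove Y Yw)) size)

    in-Y : ∀ v → (Y ∖ w) v ≡ true → Y v ≡ true
    in-Y v = proj₂ ∘ ∧-true {not (does (v ≟ w))}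

  module Unfiring (eulerian : Eulerian G) (out-pos : ∀ v → v ≢ s → 1 ≤ outdeg G v)
                  {R : ArcSet n} (R⊆G : R ⊆Arcs G) (acyclic : Acyclic R) where

    outdeg-split : ∀ X v → outdeg G v ≡ arcsFrom (arc G) X v + arcsFrom (arc G) (∁ X) v
    outdeg-split X v = trans (sym (eulerian v)) (indeg-split (arc G) X v)

    -- The configuration from which firing X once yields y: members of X get
    -- back the chips they sent outside X, the others return what they received.
    unfire : VertexSet n → Config n → Config n
    unfire X y v = if does (v ≟ s) then 0
                   else (if X v then y v + arcsFrom (arc G) (∁ X) v else y v ∸ arcsFrom (arc G) X v)

    unfire-sink : ∀ X y → unfire X y s ≡ 0
    unfire-sink X y rewrite dec-true (s ≟ s) refl = refl

    unfire-in : ∀ X y v → v ≢ s → X v ≡ true → unfire X y v ≡ y v + arcsFrom (arc G) (∁ X) v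
    unfire-in X y v v≢s Xv rewrite dec-false (v ≟ s) v≢s | Xv = refl

    unfire-out : ∀ X y v → v ≢ s → X v ≡ false → unfire X y v ≡ y v ∸ arcsFrom (arc G) X v
    unfire-out X y v v≢s Xv rewrite dec-false (v ≟ s) v≢s | Xv = refl

    unfire→* : ∀ X y → (∀ v → X v ≡ true → v ≢ s) → y s ≡ 0 →
      (∀ v → v ≢ s → X v ≡ false → arcsFrom (arc G) X v ≤ y v) →
      (∀ v → X v ≡ true → arcsFrom (arc G) X v ≤ arcsFrom R X v + y v) →
      unfire X y →* y
    unfire→* X y X-nonsink ys returnable ready =
      fire-set R⊆G acyclic _ X refl X-nonsink (λ v Xv → out-pos v (X-nonsink v Xv))
               (unfire-sink X y) ys balanced unfired-ready
      where
      balanced : Balanced X (unfire X y) y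
      balanced v v≢s = by-cases (X v) refl
        where
        open ≡-Reasoning
        by-cases : ∀ b → X v ≡ b → unfire X y v + arcsFrom (arc G) X v ≡ y v + load X v
        by-cases true Xv = begin
          unfire X y v + arcsFrom (arc G) X v                        ≡⟨ cong (_+ arcsFrom (arc G) X v) (unfire-in X y v v≢s Xv) ⟩
          y v + arcsFrom (arc G) (∁ X) v + arcsFrom (arc G) X v      ≡⟨ +-assoc (y v) _ _ ⟩
          y v + (arcsFrom (arc G) (∁ X) v + arcsFrom (arc G) X v)    ≡⟨ cong (y v +_) (+-comm _ (arcsFrom (arc G) X v)) ⟩
          y v + (arcsFrom (arc G) X v + arcsFrom (arc G) (∁ X) v)    ≡⟨ cong (y v +_) (sym (outdeg-split X v)) ⟩
          y v + outdeg G v                                           ≡⟨ cong (λ b → y v + (if b then outdeg G v else 0)) (sym Xv) ⟩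
          y v + load X v                                             ∎
        by-cases false Xv = begin
          unfire X y v + arcsFrom (arc G) X v               ≡⟨ cong (_+ arcsFrom (arc G) X v) (unfire-out X y v v≢s Xv) ⟩
          y v ∸ arcsFrom (arc G) X v + arcsFrom (arc G) X v ≡⟨ m∸n+n≡m (returnable v v≢s Xv) ⟩
          y v                                               ≡⟨ sym (+-identityʳ (y v)) ⟩
          y v + 0                                           ≡⟨ cong (λ b → y v + (if b then outdeg G v else 0)) (sym Xv) ⟩
          y v + load X v                                    ∎

      unfired-ready : Ready R X (unfire X y)
      unfired-ready v Xv = begin
        outdeg G v                                                         ≡⟨ outdeg-split X v ⟩
        arcsFrom (arc G) X v + arcsFrom (arc G) (∁ X) v                    ≤⟨ +-monoˡ-≤ _ (ready v Xv) ⟩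
        arcsFrom R X v + y v + arcsFrom (arc G) (∁ X) v                    ≡⟨ +-assoc (arcsFrom R X v) _ _ ⟩
        arcsFrom R X v + (y v + arcsFrom (arc G) (∁ X) v)                  ≡⟨ +-comm (arcsFrom R X v) _ ⟩
        y v + arcsFrom (arc G) (∁ X) v + arcsFrom R X v                    ≡⟨ cong (_+ arcsFrom R X v) (sym (unfire-in X y v (X-nonsink v Xv) Xv)) ⟩
        unfire X y v + arcsFrom R X v                                      ∎
        where open ≤-Reasoning

    unfire^ : ℕ → VertexSet n → Config n → Config n
    unfire^ zero    X y = y
    unfire^ (suc m) X y = unfire X (unfire^ m X y)

    unfire^-sink : ∀ m X y → y s ≡ 0 → unfire^ m X y s ≡ 0
    unfire^-sink zero    X y ys = ys
    unfire^-sink (suc m) X y ys = unfire-sink X (unfire^ m X y)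

    unfire^-in : ∀ m X y v → v ≢ s → X v ≡ true →
      unfire^ m X y v ≡ y v + m * arcsFrom (arc G) (∁ X) v
    unfire^-in zero    X y v v≢s Xv = sym (+-identityʳ (y v))
    unfire^-in (suc m) X y v v≢s Xv = begin
      unfire X (unfire^ m X y) v                       ≡⟨ unfire-in X (unfire^ m X y) v v≢s Xv ⟩
      unfire^ m X y v + gain                           ≡⟨ cong (_+ gain) (unfire^-in m X y v v≢s Xv) ⟩
      y v + m * gain + gain                            ≡⟨ +-assoc (y v) _ gain ⟩
      y v + (m * gain + gain)                          ≡⟨ cong (y v +_) (+-comm (m * gain) gain) ⟩
      y v + suc m * gain                               ∎
      where
      open ≡-Reasoning
      gain : ℕ
      gain = arcsFrom (arc G) (∁ X) v

    unfire^-out : ∀ m X y v → v ≢ s → X v ≡ false →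
      unfire^ m X y v ≡ y v ∸ m * arcsFrom (arc G) X v
    unfire^-out zero    X y v v≢s Xv = refl
    unfire^-out (suc m) X y v v≢s Xv = begin
      unfire X (unfire^ m X y) v                       ≡⟨ unfire-out X (unfire^ m X y) v v≢s Xv ⟩
      unfire^ m X y v ∸ loss                           ≡⟨ cong (_∸ loss) (unfire^-out m X y v v≢s Xv) ⟩
      y v ∸ m * loss ∸ loss                            ≡⟨ ∸-+-assoc (y v) (m * loss) loss ⟩
      y v ∸ (m * loss + loss)                          ≡⟨ cong (y v ∸_) (+-comm (m * loss) loss) ⟩
      y v ∸ suc m * loss                               ∎
      where
      open ≡-Reasoning
      loss : ℕ
      loss = arcsFrom (arc G) X v

    unfire^→* : ∀ m X y → (∀ v → X v ≡ true → v ≢ s) → y s ≡ 0 →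
      (∀ v → v ≢ s → X v ≡ false → m * arcsFrom (arc G) X v ≤ y v) →
      (∀ v → X v ≡ true → arcsFrom (arc G) X v ≤ arcsFrom R X v + y v) →
      unfire^ m X y →* y
    unfire^→* zero    X y X-nonsink ys affordable ready = done (λ _ → refl)
    unfire^→* (suc m) X y X-nonsink ys affordable ready =
      →*-trans (unfire→* X z X-nonsink (unfire^-sink m X y ys) returnable ready-z)
               (unfire^→* m X y X-nonsink ys (λ v v≢s Xv → m+n≤o⇒n≤o _ (affordable v v≢s Xv)) ready)
      where
      z : Config n
      z = unfire^ m X y

      returnable : ∀ v → v ≢ s → X v ≡ false → arcsFrom (arc G) X v ≤ z v
      returnable v v≢s Xv =
        subst (_ ≤_) (sym (unfire^-out m X y v v≢s Xv)) (m+n≤o⇒m≤o∸n _ (affordable v v≢s Xv))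

      ready-z : ∀ v → X v ≡ true → arcsFrom (arc G) X v ≤ arcsFrom R X v + z v
      ready-z v Xv = ≤-trans (ready v Xv) (+-monoʳ-≤ (arcsFrom R X v)
        (subst (y v ≤_) (sym (unfire^-in m X y v (X-nonsink v Xv) Xv)) (m≤m+n (y v) _)))

module MaximalAcyclicConfiguration {n} (G : Digraph n) (s : Fin n) (A : ArcSet n)
  (eulerian : Eulerian G) (A⊆G : A ⊆Arcs G) (acyclic : Acyclic A)
  (maximal : ∀ x y → arc G x y ≡ true → A x y ≡ false → ¬ Acyclic (addArc A x y))
  (s-source : indegA A s ≡ 0) (only-source : ∀ v → indegA A v ≡ 0 → v ≡ s) where

  open ChipFiring G s
  open Firing G s

  c : Config n
  c = configOf G s A

  c-sink : c s ≡ 0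
  c-sink with s ≟ s
  ... | yes _  = refl
  ... | no s≢s = ⊥-elim (s≢s refl)

  c-value : ∀ v → v ≢ s → c v ≡ outdeg G v ∸ indegA A v
  c-value v v≢s with v ≟ s
  ... | yes v≡s = ⊥-elim (v≢s v≡s)
  ... | no _    = refl

  indegA-pos : ∀ v → v ≢ s → 1 ≤ indegA A v
  indegA-pos v v≢s = n≢0⇒n>0 (v≢s ∘ only-source v)

  indegA≤outdeg : ∀ v → indegA A v ≤ outdeg G v
  indegA≤outdeg v = begin
    indegA A v                ≡⟨ indegA-count A v ⟩
    count (λ u → A u v)       ≤⟨ count-mono (λ u → A⊆G u v) ⟩
    count (λ u → arc G u v)   ≡⟨ sym (indegA-count (arc G) v) ⟩
    indeg G v                 ≡⟨ eulerian v ⟩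
    outdeg G v                ∎
    where open ≤-Reasoning

  outdeg-pos : ∀ v → v ≢ s → 1 ≤ outdeg G v
  outdeg-pos v v≢s = ≤-trans (indegA-pos v v≢s) (indegA≤outdeg v)

  A-predecessor : ∀ v → v ≢ s → ∃ λ u → A u v ≡ true
  A-predecessor v v≢s = count-witness (λ u → A u v) (subst (1 ≤_) (indegA-count A v) (indegA-pos v v≢s))

  open Unfiring eulerian outdeg-pos A⊆G acyclic

  -- At a non-sink vertex v, c(v) counts the arcs of G ∖ A entering v: for any X,
  -- the G-arcs entering v (from X and from outside) are c(v) plus the A-arcs.
  c-balance : ∀ X v → v ≢ s →
    arcsFrom (arc G) X v + arcsFrom (arc G) (∁ X) v ≡ c v + arcsFrom A X v + arcsFrom A (∁ X) v
  c-balance X v v≢s = begin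
    arcsFrom (arc G) X v + arcsFrom (arc G) (∁ X) v ≡⟨ sym (outdeg-split X v) ⟩
    outdeg G v                                      ≡⟨ sym (m∸n+n≡m (indegA≤outdeg v)) ⟩
    outdeg G v ∸ indegA A v + indegA A v            ≡⟨ cong₂ _+_ (sym (c-value v v≢s)) (indeg-split A X v) ⟩
    c v + (arcsFrom A X v + arcsFrom A (∁ X) v)     ≡⟨ sym (+-assoc (c v) _ _) ⟩
    c v + arcsFrom A X v + arcsFrom A (∁ X) v       ∎
    where open ≡-Reasoning

  -- Hence a vertex holding c(v) chips is ready to fire once its A-predecessors
  -- in X have fired.
  c-ready : ∀ X v → v ≢ s → arcsFrom (arc G) X v ≤ arcsFrom A X v + c v
  c-ready X v v≢s = +-cancelʳ-≤ (arcsFrom (arc G) (∁ X) v) _ _ (begin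
    arcsFrom (arc G) X v + arcsFrom (arc G) (∁ X) v ≡⟨ c-balance X v v≢s ⟩
    c v + arcsFrom A X v + arcsFrom A (∁ X) v       ≤⟨ +-monoʳ-≤ _ (count-mono from-outside) ⟩
    c v + arcsFrom A X v + arcsFrom (arc G) (∁ X) v ≡⟨ cong (_+ arcsFrom (arc G) (∁ X) v) (+-comm (c v) (arcsFrom A X v)) ⟩
    arcsFrom A X v + c v + arcsFrom (arc G) (∁ X) v ∎)
    where
    open ≤-Reasoning
    from-outside : ∀ u → not (X u) ∧ A u v ≡ true → not (X u) ∧ arc G u v ≡ true
    from-outside u outside-arc = let (out , Auv) = ∧-true {not (X u)} outside-arc in ∧-intro out (A⊆G u v Auv)

  stable : Stable c
  stable v (v≢s , _ , enough) = <⇒≱ fewer enough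
    where
    fewer : c v < outdeg G v
    fewer = subst (_< outdeg G v) (sym (c-value v v≢s))
                  (∸-monoʳ-< (indegA-pos v v≢s) (indegA≤outdeg v))

  layer : ℕ → VertexSet n
  layer zero    v = not (does (v ≟ s))
  layer (suc j) v = layer j v ∧ (arcsFrom (arc G) (∁ (layer j)) v ≡ᵇ 0)

  layer-shrinks : ∀ j v → layer (suc j) v ≡ true → layer j v ≡ true
  layer-shrinks j v = proj₁ ∘ ∧-true {layer j v}

  layer-nonsink : ∀ j v → layer j v ≡ true → v ≢ s
  layer-nonsink zero    v in-layer refl rewrite dec-true (s ≟ s) refl with in-layer
  ... | ()
  layer-nonsink (suc j) v in-layer = layer-nonsink j v (layer-shrinks j v in-layer)

  leaving-layer : ∀ j v → layer j v ≡ true → layer (suc j) v ≡ false →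
    1 ≤ arcsFrom (arc G) (∁ (layer j)) v
  leaving-layer j v in-j not-in-next with arcsFrom (arc G) (∁ (layer j)) v
  ... | suc _ = s≤s z≤n
  ... | zero rewrite in-j with not-in-next
  ...   | ()

  -- Every nonempty set X of non-sink vertices is entered by a G-arc: an
  -- A-source of X has an A-predecessor, which lies outside X.
  entering-arc : (X : VertexSet n) → (∀ v → X v ≡ true → v ≢ s) → ∀ {x} → X x ≡ true →
    ∃ λ u → X u ≡ true × 1 ≤ arcsFrom (arc G) (∁ X) u
  entering-arc X X-nonsink Xx with acyclic-source acyclic X Xx
  ... | u , Xu , no-A-from-X with A-predecessor u (X-nonsink u Xu)
  ...   | w , Awu = u , Xu , count-member (λ v → not (X v) ∧ arc G v u) w
                              (∧-intro (cong not outside) (A⊆G w u Awu))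
    where
    outside : X w ≡ false
    outside = ∧-false (count-zero (λ v → X v ∧ A v u) no-A-from-X w) Awu

  layer-step : ∀ j → count (layer (suc j)) ≤ count (layer j) ∸ 1
  layer-step j with count (layer j) in size
  ... | zero  = ≤-trans (count-mono (layer-shrinks j)) (≤-reflexive size)
  ... | suc k with entering-arc (layer j) (layer-nonsink j)
                     (proj₂ (count-witness (layer j) (subst (1 ≤_) (sym size) (s≤s z≤n))))
  ...   | u , u-in , entered = begin
    count (layer (suc j))  ≤⟨ count-mono next⊆rest ⟩
    count (layer j ∖ u)    ≡⟨ suc-injective (trans (sym (count-remove (layer j) u-in)) size) ⟩
    k                      ∎
    where
    open ≤-Reasoning
    u-leaves : layer (suc j) u ≡ false
    u-leaves rewrite u-in = positive entered
      where positive : ∀ {m} → 1 ≤ m → (m ≡ᵇ 0) ≡ false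
            positive (s≤s _) = refl
    next⊆rest : ∀ v → layer (suc j) v ≡ true → (layer j ∖ u) v ≡ true
    next⊆rest v in-next with v ≟ u
    ... | no _     = layer-shrinks j v in-next
    ... | yes refl with trans (sym in-next) u-leaves
    ...   | ()

  layer-size : ∀ j → count (layer j) ≤ n ∸ j
  layer-size zero    = count≤size (layer zero)
  layer-size (suc j) = begin
    count (layer (suc j)) ≤⟨ layer-step j ⟩
    count (layer j) ∸ 1   ≤⟨ ∸-monoˡ-≤ 1 (layer-size j) ⟩
    n ∸ j ∸ 1             ≡⟨ ∸-+-assoc n j 1 ⟩
    n ∸ (j + 1)           ≡⟨ cong (n ∸_) (+-comm j 1) ⟩
    n ∸ suc j             ∎
    where open ≤-Reasoning

  last-layer-empty : ∀ v → layer n v ≡ false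
  last-layer-empty = count-zero (layer n) (n≤0⇒n≡0 (≤-trans (layer-size n) (≤-reflexive (n∸n≡0 n))))

  -- Pumping: for every j and t some configuration relaxing to c has at least
  -- c(v) chips on layer j and at least t chips on every other non-sink vertex.
  -- (Unfire layer j t times: vertices leaving the layer gain ≥ 1 chip per round,
  -- the others outside lose ≤ n per round.)
  Pumped : ℕ → ℕ → Config n → Set
  Pumped j t y = y →* c × y s ≡ 0 × (∀ v → layer j v ≡ true → c v ≤ y v)
                 × (∀ v → v ≢ s → layer j v ≡ false → t ≤ y v)

  pump : ∀ j t → ∃ (Pumped j t)
  pump zero t = c , done (λ _ → refl) , c-sink , (λ _ _ → ≤-refl) , impossible
    where
    impossible : ∀ v → v ≢ s → layer zero v ≡ false → t ≤ c v
    impossible v v≢s outside with trans (sym (cong not (dec-false (v ≟ s) v≢s))) outside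
    ... | ()
  pump (suc j) t with pump j (t + t * n)
  ... | y , y→c , ys , y-on , y-off = z , →*-trans z→y y→c , unfire^-sink t X y ys , z-on , z-off
    where
    X : VertexSet n
    X = layer j
    z : Config n
    z = unfire^ t X y

    affordable : ∀ v → v ≢ s → X v ≡ false → t * arcsFrom (arc G) X v ≤ y v
    affordable v v≢s outside =
      ≤-trans (*-monoʳ-≤ t (count≤size _)) (≤-trans (m≤n+m (t * n) t) (y-off v v≢s outside))

    z→y : z →* y
    z→y = unfire^→* t X y (layer-nonsink j) ys affordable
            (λ v in-X → ≤-trans (c-ready X v (layer-nonsink j v in-X)) (+-monoʳ-≤ _ (y-on v in-X)))

    z-in : ∀ v → X v ≡ true → z v ≡ y v + t * arcsFrom (arc G) (∁ X) v
    z-in v in-X = unfire^-in t X y v (layer-nonsink j v in-X) in-X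

    z-on : ∀ v → layer (suc j) v ≡ true → c v ≤ z v
    z-on v in-next = let in-X = layer-shrinks j v in-next in
      ≤-trans (y-on v in-X) (subst (y v ≤_) (sym (z-in v in-X)) (m≤m+n (y v) _))

    z-off : ∀ v → v ≢ s → layer (suc j) v ≡ false → t ≤ z v
    z-off v v≢s not-next = by-cases (X v) refl
      where
      by-cases : ∀ b → X v ≡ b → t ≤ z v
      by-cases true in-X = subst (t ≤_) (sym (z-in v in-X))
        (≤-trans (≤-reflexive (sym (*-identityʳ t)))
          (≤-trans (*-monoʳ-≤ t (leaving-layer j v in-X not-next)) (m≤n+m _ (y v))))
      by-cases false outside = subst (t ≤_) (sym (unfire^-out t X y v v≢s outside))
        (m+n≤o⇒m≤o∸n t (≤-trans (+-monoʳ-≤ t (*-monoʳ-≤ t (count≤size _))) (y-off v v≢s outside)))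

  -- c is accessible: pump past the last layer with t = Σ d, then top d up.
  accessible : Accessible c
  accessible d ds with pump n (∑[ v < n ] d v)
  ... | y , y→c , ys , _ , y-off = d' , d'-sink , →*-resp d+d'≈y y→c
    where
    d≤y : ∀ v → d v ≤ y v
    d≤y v with v ≟ s
    ... | yes refl = subst (_≤ y s) (sym ds) z≤n
    ... | no v≢s   = ≤-trans (∑-term d v) (y-off v v≢s (last-layer-empty v))

    d' : Config n
    d' v = y v ∸ d v
    d'-sink : d' s ≡ 0
    d'-sink rewrite ds = ys
    d+d'≈y : (d ⊕ d') ≈C y
    d+d'≈y v = m+[n∸m]≡n (d≤y v)

  recurrent : Recurrent c
  recurrent = c-sink , stable , accessible

  module Deficit (c' : Config n) (c'≤c : c' ≤C c) {w} (deficit : c' w < c w)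
                 (reach? : ∀ x → Dec (Reach A w x)) where

    S : VertexSet n
    S x = does (reach? x)

    S-reach : ∀ x → S x ≡ true → Reach A w x
    S-reach x Sx with reach? x
    ... | yes w⇝x = w⇝x

    reach-S : ∀ x → Reach A w x → S x ≡ true
    reach-S x = dec-true (reach? x)

    w≢s : w ≢ s
    w≢s refl = <⇒≱ deficit (subst (_≤ c' s) (sym c-sink) z≤n)

    S-nonsink : ∀ x → S x ≡ true → x ≢ s
    S-nonsink x Sx refl with reach-last (S-reach x Sx)
    ... | inj₁ w≡s            = w≢s w≡s
    ... | inj₂ (y , _ , Ays) with subst (1 ≤_) (trans (sym (indegA-count A s)) s-source)
                                        (count-member (λ u → A u s) y Ays)
    ...   | ()

    -- By maximality, a G-arc u → v entering S is in A: otherwise adding it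
    -- would keep A acyclic, since v reaching u would put u in S.
    entering-in-A : ∀ u v → S v ≡ true → S u ≡ false → arc G u v ≡ true → A u v ≡ true
    entering-in-A u v Sv Su Guv with A u v in Auv
    ... | true  = refl
    ... | false = ⊥-elim (maximal u v Guv Auv (addArc-acyclic acyclic v⇝̸u))
      where
      v⇝̸u : ¬ Reach A v u
      v⇝̸u v⇝u with trans (sym (reach-S u (S-reach v Sv ◅◅ v⇝u))) Su
      ... | ()

    -- c'(v) < c(v) + (A-arcs from S into v) ≤ (G-arcs from S into v).
    tight : ∀ v → S v ≡ true → c' v < arcsFrom (arc G) S v
    tight v Sv = ≤-trans surplus c+A≤G
      where
      open ≤-Reasoning
      v≢s : v ≢ s
      v≢s = S-nonsink v Sv

      surplus : suc (c' v) ≤ c v + arcsFrom A S v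
      surplus with reach-last (S-reach v Sv)
      ... | inj₁ refl = ≤-trans deficit (m≤m+n (c v) _)
      ... | inj₂ (y , w⇝y , Ayv) = begin
        suc (c' v)                ≡⟨ +-comm 1 (c' v) ⟩
        c' v + 1                  ≤⟨ +-mono-≤ (c'≤c v) (count-member (λ u → S u ∧ A u v) y (∧-intro (reach-S y w⇝y) Ayv)) ⟩
        c v + arcsFrom A S v      ∎

      c+A≤G : c v + arcsFrom A S v ≤ arcsFrom (arc G) S v
      c+A≤G = +-cancelʳ-≤ (arcsFrom A (∁ S) v) _ _ (begin
        c v + arcsFrom A S v + arcsFrom A (∁ S) v          ≡⟨ sym (c-balance S v v≢s) ⟩
        arcsFrom (arc G) S v + arcsFrom (arc G) (∁ S) v    ≤⟨ +-monoʳ-≤ _ (count-mono entering) ⟩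
        arcsFrom (arc G) S v + arcsFrom A (∁ S) v          ∎)
        where
        entering : ∀ u → not (S u) ∧ arc G u v ≡ true → not (S u) ∧ A u v ≡ true
        entering u outside-arc with ∧-true {not (S u)} outside-arc
        ... | (outside , Guv) = ∧-intro outside (entering-in-A u v Sv (not-true outside) Guv)

  -- A recurrent c' ≤ c equals c: a deficit would make S violate
  -- stable-accessible-slack.  Reachability need only be decidable in the
  -- double-negation sense, as the goal is ⊥.
  minimal : ∀ c' → Recurrent c' → c' ≤C c → c' ≈C c
  minimal c' (_ , stable' , accessible') c'≤c v with c' v ℕ.≟ c v
  ... | yes same  = same
  ... | no differ = ⊥-elim (¬¬-decidable (Reach A v) no-slack)
    where
    no-slack : (∀ x → Dec (Reach A v x)) → ⊥
    no-slack reach? =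
      let open Deficit c' c'≤c (≤∧≢⇒< (c'≤c v) differ) reach?
          (u , Su , slack) = stable-accessible-slack outdeg-pos stable' accessible' S S-nonsink (reach-S v ε)
      in <⇒≱ (tight u Su) slack

lemma14 : ∀ {n} (G : Digraph n) (s : Fin n) (A : ArcSet n) →
          Connected G → Eulerian G →
          MaximalAcyclic G A →
          indegA A s ≡ 0 → (∀ v → indegA A v ≡ 0 → v ≡ s) →
          ChipFiring.MinimalRecurrent G s (configOf G s A)
lemma14 G s A _ eulerian (A⊆G , acyclic , maximal) s-source only-source = recurrent , minimal
  where open MaximalAcyclicConfiguration G s A eulerian A⊆G acyclic maximal s-source only-source
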